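{- In an edge iterated graph system, every primitive block of the degree matrix $\mathbf N$ projects under $\pi$ into a unique primitive block of the mass matrix $\mathbf M$. In particular, $\mathfrak h_{\mathbf N}\ge\mathfrak h_{\mathbf M}$.
   Context: EIGS: $K\ge1$ colours; for $i\in[K]$, $R_i$ is a finite connected directed graph with edges coloured in $[K]$ and two planting vertices $\beta_i^+,\beta_i^-$. Mass matrix $\mathbf M\in\mathbb N^{K\times K}$: $[\mathbf M]_{ik}$ = number of colour-$k$ edges of $R_i$. For a vertex $v$ of a coloured digraph $G$, $\boldsymbol\kappa_G(v)\in\mathbb N^{1\times 2K}$ has entry $2i-1$ = number of outgoing colour-$i$ edges at $v$ and entry $2i$ = number of incoming colour-$i$ edges. Degree matrix $\mathbf N\in\mathbb N^{2K\times 2K}$: rows $2i-1$ and $2i$ are $\boldsymbol\kappa_{R_i}(\beta_i^+)$ and $\boldsymbol\kappa_{R_i}(\beta_i^-)$. The projection $\pi:[2K]\to[K]$ is $\pi(2i-1)=\pi(2i)=i$. Frobenius notions: for a nonnegative square matrix $\mathbf X$, the blocks (index sets of diagonal blocks of the Frobenius normal form) are the classes of mutual reachability ($a$ reaches $b$ iff $[\mathbf X^n]_{ab}>0$ for some $n\ge0$); $\mathfrak h_{\mathbf X}$ is their number. Standing assumption: all matrices considered are primitive-Frobenius (every diagonal block primitive), and blocks are called primitive blocks. -}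

module Defs where

open import Data.Nat using (ℕ; zero; suc; _+_; _*_; _<_; _≤_)
open import Data.Fin using (Fin; zero; suc; remQuot; quotient)
open import Data.Fin.Subset using (Subset; _∈_)
open import Data.Product using (Σ; ∃; _×_; _,_; proj₁; proj₂)
open import Data.Sum using (_⊎_)
open import Data.Bool using (Bool; true; false; if_then_else_; _∧_)
open import Data.Vec using (lookup)
open import Relation.Nullary using (does)
open import Relation.Binary.PropositionalEquality using (_≡_)
open import Relation.Binary.Construct.Closure.ReflexiveTransitive using (Star)
open import Function.Bundles using (_⇔_)
open import Function.Definitions using (Injective)
import Data.Fin as F

∑ : ∀ {n} → (Fin n → ℕ) → ℕ
∑ {zero}  f = 0
∑ {suc n} f = f zero + ∑ (λ i → f (suc i))

count : ∀ {n} → (Fin n → Bool) → ℕ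
count P = ∑ (λ i → if P i then 1 else 0)

Mat : ℕ → Set
Mat n = Fin n → Fin n → ℕ

idMat : ∀ {n} → Mat n
idMat a b = if does (a F.≟ b) then 1 else 0

_⊗_ : ∀ {n} → Mat n → Mat n → Mat n
(X ⊗ Y) a b = ∑ (λ c → X a c * Y c b)

_^^_ : ∀ {n} → Mat n → ℕ → Mat n
X ^^ zero  = idMat
X ^^ suc k = X ⊗ (X ^^ k)

Reaches : ∀ {n} → Mat n → Fin n → Fin n → Set
Reaches X a b = ∃ λ k → 0 < (X ^^ k) a b

MutReach : ∀ {n} → Mat n → Fin n → Fin n → Set
MutReach X a b = Reaches X a b × Reaches X b a

IsBlock : ∀ {n} → Mat n → Subset n → Set
IsBlock {n} X B = (∃ λ a → a ∈ B) × (∀ a b → a ∈ B → (b ∈ B ⇔ MutReach X a b))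

-- principal submatrix on B, padded with zeros outside B
restrict : ∀ {n} → Mat n → Subset n → Mat n
restrict X B a b = if lookup B a ∧ lookup B b then X a b else 0

PrimitiveOn : ∀ {n} → Mat n → Subset n → Set
PrimitiveOn X B = ∃ λ k → 1 ≤ k × (∀ a b → a ∈ B → b ∈ B → 0 < (restrict X B ^^ k) a b)

-- primitive-Frobenius: every diagonal block of the Frobenius normal form is primitive
PrimitiveFrobenius : ∀ {n} → Mat n → Set
PrimitiveFrobenius X = ∀ B → IsBlock X B → PrimitiveOn X B

-- 𝔥_X = h : the blocks of X are enumerated without repetition by Fin h
BlockCount : ∀ {n} → Mat n → ℕ → Set
BlockCount {n} X h =
  Σ (Fin h → Subset n) λ f →
    Injective _≡_ _≡_ f × (∀ j → IsBlock X (f j)) × (∀ B → IsBlock X B → ∃ λ j → f j ≡ B)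

record ColouredGraph (K : ℕ) : Set where
  field
    V E    : ℕ
    src tgt : Fin E → Fin V
    colour : Fin E → Fin K

open ColouredGraph public

-- (weak) connectivity: any two vertices are joined by a walk ignoring directions
Adjacent : ∀ {K} (G : ColouredGraph K) → Fin (V G) → Fin (V G) → Set
Adjacent G u v = ∃ λ e → (src G e ≡ u × tgt G e ≡ v) ⊎ (src G e ≡ v × tgt G e ≡ u)

Connected : ∀ {K} → ColouredGraph K → Set
Connected G = ∀ u v → Star (Adjacent G) u v

numColour : ∀ {K} (G : ColouredGraph K) → Fin K → ℕ
numColour G k = count (λ e → does (colour G e F.≟ k))

-- κ_G(v), 0-based: entry (combine i 0) = out colour-i edges, (combine i 1) = in colour-i edges
κ : ∀ {K} (G : ColouredGraph K) → Fin (V G) → Fin (K * 2) → ℕ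
κ {K} G v j with remQuot {K} 2 j
... | (i , zero)  = count (λ e → does (colour G e F.≟ i) ∧ does (src G e F.≟ v))
... | (i , suc _) = count (λ e → does (colour G e F.≟ i) ∧ does (tgt G e F.≟ v))

record EIGS (K : ℕ) : Set where
  field
    R         : Fin K → ColouredGraph K
    connected : ∀ i → Connected (R i)
    β⁺ β⁻     : (i : Fin K) → Fin (V (R i))

  M : Mat K
  M i k = numColour (R i) k

  -- degree matrix: row (combine i 0) is κ(β⁺ i), row (combine i 1) is κ(β⁻ i)
  N : Mat (K * 2)
  N a b with remQuot {K} 2 a
  ... | (i , zero)  = κ (R i) (β⁺ i) b
  ... | (i , suc _) = κ (R i) (β⁻ i) b

π : ∀ {K} → Fin (K * 2) → Fin K
π {K} = quotient {K} 2

-- Every entry of N is bounded by the entry of M at the projected indices: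
-- a colour-k edge at a planting vertex of R_i is in particular a colour-k edge
-- of R_i. Hence every edge of the graph of N projects under π to an edge of the
-- graph of M, mutual reachability for N projects to mutual reachability for M,
-- and each block of N lands in the block of M containing the image of any of its
-- points. Since π has the section i ↦ 2i-1, distinct blocks of M pull back to
-- distinct blocks of N, so 𝔥_M ≤ 𝔥_N.
module Submission where

open import Defs
open import Data.Nat using (ℕ; zero; suc; _≤_; _<_; _<?_; _*_; z≤n; s≤s)
open import Data.Nat.Properties using (≤-refl; ≤-trans; <-≤-trans; m≤m+n; m≤n+m; +-mono-≤; *-zeroʳ; n≮0)
open import Data.Fin using (Fin; zero; suc; combine; quotRem)
import Data.Fin as F
open import Data.Fin.Properties using (any?; injective⇒≤; remQuot-combine)
open import Data.Fin.Subset using (Subset; _∈_; _⊆_; _⊃_; _∪_; ⁅_⁆)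
open import Data.Fin.Subset.Properties using (_∈?_; _⊂?_; ⊆-antisym; p⊆p∪q; x∈p∪q⁻; x∈p∪q⁺; x∈⁅x⁆; x∈⁅y⁆⇒x≡y)
open import Data.Fin.Subset.Induction using (Acc; acc; ⊃-wellFounded)
open import Data.Product using (Σ; ∃; _×_; _,_; proj₁; proj₂)
open import Data.Sum using (inj₁; inj₂)
open import Data.Bool using (Bool; true; false; _∧_; if_then_else_)
open import Data.Vec using (tabulate)
open import Data.Vec.Properties using (lookup∘tabulate; []=⇒lookup; lookup⇒[]=)
open import Level using (0ℓ)
open import Relation.Nullary using (yes; no; does; contradiction)
open import Relation.Nullary.Decidable using (_×-dec_; map′)
open import Relation.Unary using (Pred; Decidable)
open import Relation.Binary using (Rel)
import Relation.Binary.Definitions as B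
open import Relation.Binary.PropositionalEquality using (_≡_; refl; sym; trans; cong; subst; subst₂)
open import Relation.Binary.Construct.Closure.ReflexiveTransitive using (Star; ε; _◅_; _◅◅_; gmap)
open import Function.Bundles using (_⇔_; mk⇔; Equivalence)

open Equivalence using (to; from)

∑-pos⇒∃pos : ∀ {n} (f : Fin n → ℕ) → 0 < ∑ f → ∃ λ i → 0 < f i
∑-pos⇒∃pos {suc _} f p with f zero in eq
... | suc _ = zero , subst (0 <_) (sym eq) (s≤s z≤n)
... | zero with ∑-pos⇒∃pos (λ i → f (suc i)) p
...   | i , q = suc i , q

term≤∑ : ∀ {n} (f : Fin n → ℕ) i → f i ≤ ∑ f
term≤∑ f zero    = m≤m+n _ _
term≤∑ f (suc i) = ≤-trans (term≤∑ (λ j → f (suc j)) i) (m≤n+m _ (f zero))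

∑-mono-≤ : ∀ {n} {f g : Fin n → ℕ} → (∀ i → f i ≤ g i) → ∑ f ≤ ∑ g
∑-mono-≤ {zero}  f≤g = z≤n
∑-mono-≤ {suc _} f≤g = +-mono-≤ (f≤g zero) (∑-mono-≤ (λ i → f≤g (suc i)))

count-∧-≤ : ∀ {n} (P Q : Fin n → Bool) → count (λ i → P i ∧ Q i) ≤ count P
count-∧-≤ P Q = ∑-mono-≤ (λ i → indicator-∧-≤ (P i) (Q i))
  where
  indicator-∧-≤ : ∀ x y → (if x ∧ y then 1 else 0) ≤ (if x then 1 else 0)
  indicator-∧-≤ false y     = z≤n
  indicator-∧-≤ true  false = z≤n
  indicator-∧-≤ true  true  = ≤-refl

*-pos⇒pos : ∀ m n → 0 < m * n → 0 < m × 0 < n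
*-pos⇒pos (suc _) (suc _) _ = s≤s z≤n , s≤s z≤n
*-pos⇒pos (suc m) zero    p = contradiction (subst (0 <_) (*-zeroʳ m) p) n≮0

pos*pos⇒pos : ∀ {m n} → 0 < m → 0 < n → 0 < m * n
pos*pos⇒pos {suc _} {suc _} _ _ = s≤s z≤n

subsetOf : ∀ {n ℓ} {P : Pred (Fin n) ℓ} → Decidable P → Subset n
subsetOf P? = tabulate (λ x → does (P? x))

∈-subsetOf : ∀ {n ℓ} {P : Pred (Fin n) ℓ} (P? : Decidable P) x → x ∈ subsetOf P? ⇔ P x
∈-subsetOf P? x with P? x | lookup∘tabulate (λ y → does (P? y)) x
... | yes Px | lookup≡true  = mk⇔ (λ _ → Px) (λ _ → lookup⇒[]= x _ lookup≡true)
... | no ¬Px | lookup≡false =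
  mk⇔ (λ x∈ → contradiction (trans (sym lookup≡false) ([]=⇒lookup x∈)) λ ())
      (λ Px → contradiction Px ¬Px)

postfixedPoint-above : ∀ {n ℓ} (f : Subset n → Subset n) (Inv : Pred (Subset n) ℓ) →
  (∀ p → p ⊆ f p) → (∀ p → Inv p → Inv (f p)) →
  ∀ p → Inv p → ∃ λ q → Inv q × f q ⊆ q × p ⊆ q
postfixedPoint-above f Inv f-infl f-pres p = go p (⊃-wellFounded p)
  where
  go : ∀ p → Acc _⊃_ p → Inv p → ∃ λ q → Inv q × f q ⊆ q × p ⊆ q
  go p (acc rec) Inv-p with p ⊂? f p
  ... | yes p⊂fp with go (f p) (rec p⊂fp) (f-pres p Inv-p)
  ...   | q , Inv-q , fq⊆q , fp⊆q = q , Inv-q , fq⊆q , (λ x∈p → fp⊆q (f-infl p x∈p))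
  go p _ Inv-p | no p⊄fp = p , Inv-p , fp⊆p , (λ x∈p → x∈p)
    where
    fp⊆p : f p ⊆ p
    fp⊆p {x} x∈fp with x ∈? p
    ... | yes x∈p = x∈p
    ... | no  x∉p = contradiction ((λ {y} → f-infl p {y}) , x , x∈fp , x∉p) p⊄fp

module _ {n ℓ} {E : Rel (Fin n) ℓ} (E? : B.Decidable E) where

  successor? : ∀ p → Decidable (λ y → ∃ λ x → x ∈ p × E x y)
  successor? p y = any? (λ x → x ∈? p ×-dec E? x y)

  successors : Subset n → Subset n
  successors p = subsetOf (successor? p)

  expand : Subset n → Subset n
  expand p = p ∪ successors p

  successor∈expand : ∀ {p x y} → x ∈ p → E x y → y ∈ expand p
  successor∈expand {p} {x} {y} x∈p xEy =
    x∈p∪q⁺ (inj₂ (from (∈-subsetOf (successor? p) y) (x , x∈p , xEy)))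

  star? : B.Decidable (Star E)
  star? a b with postfixedPoint-above expand ReachedFrom-a (λ p → p⊆p∪q (successors p))
                   expand-preserves ⁅ a ⁆ (λ x∈⁅a⁆ → subst (Star E a) (sym (x∈⁅y⁆⇒x≡y a x∈⁅a⁆)) ε)
    where
    ReachedFrom-a : Pred (Subset n) ℓ
    ReachedFrom-a q = ∀ {x} → x ∈ q → Star E a x
    expand-preserves : ∀ p → ReachedFrom-a p → ReachedFrom-a (expand p)
    expand-preserves p reached {x} x∈ with x∈p∪q⁻ p (successors p) x∈
    ... | inj₁ x∈p = reached x∈p
    ... | inj₂ x∈succ with to (∈-subsetOf (successor? p) x) x∈succ
    ...   | c , c∈p , cEx = reached c∈p ◅◅ (cEx ◅ ε)
  ... | q , reached , expand-q⊆q , ⁅a⁆⊆q with b ∈? q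
  ...   | yes b∈q = yes (reached b∈q)
  ...   | no  b∉q = no (λ a⇝b → b∉q (star-closed (⁅a⁆⊆q (x∈⁅x⁆ a)) a⇝b))
    where
    star-closed : ∀ {x y} → x ∈ q → Star E x y → y ∈ q
    star-closed x∈q ε             = x∈q
    star-closed x∈q (xEz ◅ z⇝y) = star-closed (expand-q⊆q (successor∈expand x∈q xEz)) z⇝y

idMat-pos⇒≡ : ∀ {n} (a b : Fin n) → 0 < idMat a b → a ≡ b
idMat-pos⇒≡ a b pos with a F.≟ b
... | yes a≡b = a≡b
... | no  _   = contradiction pos n≮0

idMat-diagonal-pos : ∀ {n} (a : Fin n) → 0 < idMat a a
idMat-diagonal-pos a with a F.≟ a
... | yes _   = s≤s z≤n
... | no  a≢a = contradiction refl a≢a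

module _ {n} (X : Mat n) where

  Edge : Rel (Fin n) 0ℓ
  Edge a b = 0 < X a b

  power-pos⇒star : ∀ k a b → 0 < (X ^^ k) a b → Star Edge a b
  power-pos⇒star zero    a b pos with idMat-pos⇒≡ a b pos
  ... | refl = ε
  power-pos⇒star (suc k) a b pos with ∑-pos⇒∃pos (λ c → X a c * (X ^^ k) c b) pos
  ... | c , pos-c with *-pos⇒pos (X a c) ((X ^^ k) c b) pos-c
  ...   | aEc , pos-cb = aEc ◅ power-pos⇒star k c b pos-cb

  reaches⇒star : ∀ {a b} → Reaches X a b → Star Edge a b
  reaches⇒star (k , pos) = power-pos⇒star k _ _ pos

  star⇒reaches : ∀ {a b} → Star Edge a b → Reaches X a b
  star⇒reaches {a} ε = 0 , idMat-diagonal-pos a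
  star⇒reaches {a} {b} (_◅_ {j = c} aEc c⇝b) with star⇒reaches c⇝b
  ... | k , pos-cb = suc k , <-≤-trans (pos*pos⇒pos aEc pos-cb)
                                       (term≤∑ (λ c → X a c * (X ^^ k) c b) c)

  reaches-trans : ∀ {a b c} → Reaches X a b → Reaches X b c → Reaches X a c
  reaches-trans a⇝b b⇝c = star⇒reaches (reaches⇒star a⇝b ◅◅ reaches⇒star b⇝c)

  reaches? : B.Decidable (Reaches X)
  reaches? a b = map′ star⇒reaches reaches⇒star (star? (λ x y → 0 <? X x y) a b)

  mutReach? : B.Decidable (MutReach X)
  mutReach? a b = reaches? a b ×-dec reaches? b a

  mutReach-refl : ∀ a → MutReach X a a
  mutReach-refl a = star⇒reaches ε , star⇒reaches ε

  mutReach-sym : ∀ {a b} → MutReach X a b → MutReach X b a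
  mutReach-sym (a⇝b , b⇝a) = b⇝a , a⇝b

  mutReach-trans : ∀ {a b c} → MutReach X a b → MutReach X b c → MutReach X a c
  mutReach-trans (a⇝b , b⇝a) (b⇝c , c⇝b) = reaches-trans a⇝b b⇝c , reaches-trans c⇝b b⇝a

  reachClass : Fin n → Subset n
  reachClass a = subsetOf (mutReach? a)

  ∈-reachClass : ∀ a b → b ∈ reachClass a ⇔ MutReach X a b
  ∈-reachClass a = ∈-subsetOf (mutReach? a)

  a∈reachClass-a : ∀ a → a ∈ reachClass a
  a∈reachClass-a a = from (∈-reachClass a a) (mutReach-refl a)

  reachClass-isBlock : ∀ a → IsBlock X (reachClass a)
  reachClass-isBlock a = (a , a∈reachClass-a a) , λ b c b∈ →
    let a~b = to (∈-reachClass a b) b∈ in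
    mk⇔ (λ c∈ → mutReach-trans (mutReach-sym a~b) (to (∈-reachClass a c) c∈))
        (λ b~c → from (∈-reachClass a c) (mutReach-trans a~b b~c))

  blocks-overlap⇒≡ : ∀ {B B′ a} → IsBlock X B → IsBlock X B′ → a ∈ B → a ∈ B′ → B ≡ B′
  blocks-overlap⇒≡ {a = a} (_ , B-class) (_ , B′-class) a∈B a∈B′ =
    ⊆-antisym (λ {b} b∈B → from (B′-class a b a∈B′) (to (B-class a b a∈B) b∈B))
              (λ {b} b∈B′ → from (B-class a b a∈B) (to (B′-class a b a∈B′) b∈B′))

module _ {m n} {X : Mat m} {Y : Mat n} {f : Fin m → Fin n}
         (X≤Y∘f : ∀ a b → X a b ≤ Y (f a) (f b)) where

  reaches-map : ∀ {a b} → Reaches X a b → Reaches Y (f a) (f b)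
  reaches-map a⇝b = star⇒reaches Y (gmap f (λ {a} {b} aEb → <-≤-trans aEb (X≤Y∘f a b))
                                            (reaches⇒star X a⇝b))

  mutReach-map : ∀ {a b} → MutReach X a b → MutReach Y (f a) (f b)
  mutReach-map (a⇝b , b⇝a) = reaches-map a⇝b , reaches-map b⇝a

  block-image⊆unique-block : ∀ B → IsBlock X B →
    Σ (Subset n) λ C → (IsBlock Y C × (∀ a → a ∈ B → f a ∈ C))
      × (∀ C′ → IsBlock Y C′ → (∀ a → a ∈ B → f a ∈ C′) → C′ ≡ C)
  block-image⊆unique-block B ((a , a∈B) , B-class) =
    reachClass Y (f a) , (reachClass-isBlock Y (f a) , image⊆) ,
    λ C′ C′-block image⊆C′ →
      blocks-overlap⇒≡ Y C′-block (reachClass-isBlock Y (f a)) (image⊆C′ a a∈B) (a∈reachClass-a Y (f a))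
    where
    image⊆ : ∀ b → b ∈ B → f b ∈ reachClass Y (f a)
    image⊆ b b∈B = from (∈-reachClass Y (f a) (f b)) (mutReach-map (to (B-class a b a∈B) b∈B))

  -- Send a block of Y to the block of X containing the image of one of its points under the section.
  blockCount-≤ : (s : Fin n → Fin m) → (∀ i → f (s i) ≡ i) →
    ∀ {hX hY} → BlockCount X hX → BlockCount Y hY → hY ≤ hX
  blockCount-≤ s f∘s≗id {hX} {hY} (blockX , _ , _ , blockX-onto) (blockY , blockY-injective , blockY-isBlock , _) =
    injective⇒≤ {f = g} g-injective
    where
    rep : Fin hY → Fin n
    rep j = proj₁ (proj₁ (blockY-isBlock j))
    rep∈ : ∀ j → rep j ∈ blockY j
    rep∈ j = proj₂ (proj₁ (blockY-isBlock j))
    lift : Fin hY → Fin m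
    lift j = s (rep j)
    g : Fin hY → Fin hX
    g j = proj₁ (blockX-onto (reachClass X (lift j)) (reachClass-isBlock X (lift j)))
    g-spec : ∀ j → blockX (g j) ≡ reachClass X (lift j)
    g-spec j = proj₂ (blockX-onto (reachClass X (lift j)) (reachClass-isBlock X (lift j)))
    g-injective : ∀ {j j′} → g j ≡ g j′ → j ≡ j′
    g-injective {j} {j′} gj≡gj′ = blockY-injective
      (blocks-overlap⇒≡ Y (blockY-isBlock j) (blockY-isBlock j′) rep-j′∈blockY-j (rep∈ j′))
      where
      same-class : reachClass X (lift j) ≡ reachClass X (lift j′)
      same-class = trans (sym (g-spec j)) (trans (cong blockX gj≡gj′) (g-spec j′))
      lifts-mutReach : MutReach X (lift j) (lift j′)
      lifts-mutReach = to (∈-reachClass X (lift j) (lift j′))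
                          (subst (lift j′ ∈_) (sym same-class) (a∈reachClass-a X (lift j′)))
      reps-mutReach : MutReach Y (rep j) (rep j′)
      reps-mutReach = subst₂ (MutReach Y) (f∘s≗id (rep j)) (f∘s≗id (rep j′)) (mutReach-map lifts-mutReach)
      rep-j′∈blockY-j : rep j′ ∈ blockY j
      rep-j′∈blockY-j = from (proj₂ (blockY-isBlock j) (rep j) (rep j′) (rep∈ j)) reps-mutReach

-- κ and π are defined through remQuot and quotient, which both unfold to quotRem;
-- abstracting quotRem therefore splits them simultaneously.
κ≤numColour∘π : ∀ {K} (G : ColouredGraph K) v j → κ G v j ≤ numColour G (π j)
κ≤numColour∘π {K} G v j with quotRem {K} 2 j
... | zero  , i = count-∧-≤ (λ e → does (colour G e F.≟ i)) _
... | suc _ , i = count-∧-≤ (λ e → does (colour G e F.≟ i)) _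

module _ {K} (S : EIGS K) where
  open EIGS S

  N≤M∘π : ∀ a b → N a b ≤ M (π a) (π b)
  N≤M∘π a b with quotRem {K} 2 a
  ... | zero  , i = κ≤numColour∘π (R i) (β⁺ i) b
  ... | suc _ , i = κ≤numColour∘π (R i) (β⁻ i) b

π-combine : ∀ {K} (i : Fin K) → π (combine {K} {2} i zero) ≡ i
π-combine {K} i = cong proj₁ (remQuot-combine {K} {2} i zero)

proposition2p14 : (K : ℕ) → 1 ≤ K → (S : EIGS K) →
    PrimitiveFrobenius (EIGS.M S) → PrimitiveFrobenius (EIGS.N S) →
    ((B : Subset (K * 2)) → IsBlock (EIGS.N S) B →
      Σ (Subset K) λ C → (IsBlock (EIGS.M S) C × (∀ a → a ∈ B → π a ∈ C))
        × (∀ C′ → IsBlock (EIGS.M S) C′ → (∀ a → a ∈ B → π a ∈ C′) → C′ ≡ C))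
    × (∀ hN hM → BlockCount (EIGS.N S) hN → BlockCount (EIGS.M S) hM → hM ≤ hN)
proposition2p14 K _ S _ _ =
  block-image⊆unique-block (N≤M∘π S) ,
  λ _ _ → blockCount-≤ (N≤M∘π S) (λ i → combine i zero) π-combine
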